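{- Let $G$ be a finite graph, $M$ a module of $G$, and $S$ an independent set of $G$ with $|S\cap M|\ge 2$. Then for every independent set $S'$ of $G$: $S\leftrightsquigarrow S'$ in $G$ if and only if $S'\cap N(M)=\emptyset$ and $S\leftrightsquigarrow S'$ in $G-N(M)$.
   Context: Token Sliding ($\mathsf{TS}$): for independent sets $S,S'$ of a graph $H$ with $|S|=|S'|$, write $S\leftrightarrow S'$ (in $H$) if $|S\triangle S'|=2$ and the two vertices of $S\triangle S'$ are adjacent in $H$. Write $S\leftrightsquigarrow S'$ in $H$ if there exist $\ell\ge 0$ and independent sets $S_0=S,\dots,S_\ell=S'$ of $H$ with $S_{i-1}\leftrightarrow S_i$ for all $i$. A module of $G=(V,E)$ is a set $M\subseteq V$ such that every vertex of $V\setminus M$ is adjacent to all or to none of the vertices of $M$. $N(M)=\bigcup_{v\in M}N(v)\setminus M$ is the open neighborhood of $M$, and $G-N(M)$ is the subgraph induced by $V\setminus N(M)$. -}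

module Defs where

open import Data.Nat using (ℕ; _≥_)
open import Data.Fin using (Fin)
open import Data.Fin.Subset using (Subset; _∈_; _∉_; _∩_; _∪_; _─_; ∣_∣)
open import Data.Product using (_×_; ∃-syntax)
open import Data.Sum using (_⊎_)
open import Data.Unit using (⊤)
open import Relation.Nullary using (¬_)
open import Relation.Binary using (Decidable)
open import Relation.Binary.PropositionalEquality using (_≡_; _≢_)
open import Relation.Binary.Construct.Closure.ReflexiveTransitive using (Star)

record Graph (n : ℕ) : Set₁ where
  field
    Adj     : Fin n → Fin n → Set
    adj?    : Decidable Adj
    symm    : ∀ {u v} → Adj u v → Adj v u
    irrefl  : ∀ {u} → ¬ Adj u u
open Graph public

VSet : ℕ → Set₁
VSet n = Fin n → Set

allV : ∀ {n} → VSet n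
allV _ = ⊤

_△_ : ∀ {n} → Subset n → Subset n → Subset n
S △ S' = (S ─ S') ∪ (S' ─ S)

IndepIn : ∀ {n} → Graph n → VSet n → Subset n → Set
IndepIn G W S = (∀ v → v ∈ S → W v) × (∀ u v → u ∈ S → v ∈ S → ¬ Adj G u v)

Independent : ∀ {n} → Graph n → Subset n → Set
Independent G S = IndepIn G allV S

Slide : ∀ {n} → Graph n → VSet n → Subset n → Subset n → Set
Slide G W S S' =
  IndepIn G W S × IndepIn G W S' × ∣ S ∣ ≡ ∣ S' ∣ × ∣ S △ S' ∣ ≡ 2 ×
  (∀ u v → u ∈ S △ S' → v ∈ S △ S' → u ≢ v → Adj G u v)

Reach : ∀ {n} → Graph n → VSet n → Subset n → Subset n → Set
Reach G W = Star (Slide G W)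

IsModule : ∀ {n} → Graph n → Subset n → Set
IsModule G M = ∀ v → v ∉ M → (∀ u → u ∈ M → Adj G v u) ⊎ (∀ u → u ∈ M → ¬ Adj G v u)

NbhdOf : ∀ {n} → Graph n → Subset n → VSet n
NbhdOf G M v = v ∉ M × ∃[ u ] (u ∈ M × Adj G u v)

minusN : ∀ {n} → Graph n → Subset n → VSet n
minusN G M v = ¬ NbhdOf G M v

module Submission where

-- Call a vertex set T anchored in M if it contains two distinct
-- vertices of M.
--  (1) An anchored independent set avoids N(M): a vertex v ∉ M adjacent to
--      some vertex of the module M is adjacent to all of M, in particular to
--      a token of T.
--  (2) A slide S ↔ T preserves being anchored: if an anchor x slides away to
--      z, the other anchor y stays (otherwise x and y would be the two
--      adjacent vertices of S △ T, inside the independent set S), and z ∈ M,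
--      since otherwise z, being adjacent to x, would be adjacent to y ∈ T.
-- Consequently every reconfiguration sequence in G starting at S passes only
-- through anchored independent sets, which all lie in G - N(M); such a
-- sequence is therefore a sequence in G - N(M).  Conversely a slide in an
-- induced subgraph is a slide in G.

open import Defs
open import Data.Nat using (ℕ; _≥_; _≤_; s≤s; z≤n)
import Data.Nat.Properties as ℕ
open import Data.Fin using (Fin; zero; suc)
open import Data.Fin.Properties using (suc-injective)
open import Data.Fin.Subset using (Subset; _∈_; _∉_; _∩_; _─_; ∣_∣; Nonempty; inside; outside)
open import Data.Fin.Subset.Properties
  using (_∈?_; nonempty?; Empty-unique; ∣⊥∣≡0; x∈p∩q⁻; x∈p∪q⁻; x∈p∪q⁺; x∈p∧x∉q⇒x∈p─q; p─q⊆p)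
open import Data.Vec using (_∷_; here; there)
open import Data.Product using (_×_; _,_; ∃-syntax)
open import Data.Sum using (_⊎_; inj₁; inj₂)
open import Data.Unit using (tt)
open import Data.Empty using (⊥-elim)
open import Function.Bundles using (_⇔_; mk⇔)
open import Relation.Nullary using (¬_; yes; no; contradiction)
open import Relation.Binary.PropositionalEquality using (_≢_; ≢-sym; refl; sym; trans; cong)
open import Relation.Binary.Construct.Closure.ReflexiveTransitive using (ε; _◅_)
import Relation.Binary.Construct.Closure.ReflexiveTransitive as Star

private
  variable
    n : ℕ

x∈p─q⇒x∉q : ∀ (p q : Subset n) {x} → x ∈ p ─ q → x ∉ q
x∈p─q⇒x∉q (_ ∷ p) (inside  ∷ q) ()        here
x∈p─q⇒x∉q (_ ∷ p) (_       ∷ q) (there x) (there y) = x∈p─q⇒x∉q p q x y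

△-intro : ∀ (S T : Subset n) {x} → x ∈ S → x ∉ T → x ∈ S △ T
△-intro S T x∈S x∉T = x∈p∪q⁺ (inj₁ (x∈p∧x∉q⇒x∈p─q x∈S x∉T))

△-elim : ∀ (S T : Subset n) {x} → x ∈ S △ T → (x ∈ S × x ∉ T) ⊎ (x ∈ T × x ∉ S)
△-elim S T x∈S△T with x∈p∪q⁻ (S ─ T) (T ─ S) x∈S△T
... | inj₁ x∈S─T = inj₁ (p─q⊆p S T x∈S─T , x∈p─q⇒x∉q S T x∈S─T)
... | inj₂ x∈T─S = inj₂ (p─q⊆p T S x∈T─S , x∈p─q⇒x∉q T S x∈T─S)

size≥1⇒nonempty : ∀ (p : Subset n) → 1 ≤ ∣ p ∣ → Nonempty p
size≥1⇒nonempty {n} p 1≤∣p∣ with nonempty? p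
... | yes ne = ne
... | no ¬ne = contradiction (trans (cong ∣_∣ (Empty-unique ¬ne)) (∣⊥∣≡0 n)) (ℕ.n>0⇒n≢0 1≤∣p∣)

another : ∀ (p : Subset n) (a : Fin n) → 2 ≤ ∣ p ∣ → ∃[ z ] (z ∈ p × z ≢ a)
another (inside  ∷ p) zero    (s≤s 1≤∣p∣) with size≥1⇒nonempty p 1≤∣p∣
... | z , z∈p = suc z , there z∈p , λ ()
another (inside  ∷ p) (suc a) _ = zero , here , λ ()
another (outside ∷ p) zero    2≤∣p∣ with size≥1⇒nonempty p (ℕ.≤-trans (s≤s z≤n) 2≤∣p∣)
... | z , z∈p = suc z , there z∈p , λ ()
another (outside ∷ p) (suc a) 2≤∣p∣ with another p a 2≤∣p∣
... | z , z∈p , z≢a = suc z , there z∈p , λ e → z≢a (suc-injective e)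

module _ (G : Graph n) where

  slide-in-G : ∀ {W S T} → Slide G W S T → Slide G allV S T
  slide-in-G ((_ , indS) , (_ , indT) , sizes) =
    ((λ _ _ → tt) , indS) , ((λ _ _ → tt) , indT) , sizes

  reach-restrict : ∀ {W W' : VSet n} (P : Subset n → Set) →
                   (∀ {S T} → Slide G W' S T → P S → P T) →
                   (∀ {S} → P S → ∀ v → v ∈ S → W v) →
                   ∀ {S T} → Reach G W' S T → P S → Reach G W S T × P T
  reach-restrict P keep inside-W ε PS = ε , PS
  reach-restrict P keep inside-W (sl@((_ , indS) , (_ , indT) , sizes) ◅ rest) PS
    with reach-restrict P keep inside-W rest (keep sl PS)
  ... | rest' , PT' =
    ((inside-W PS , indS) , (inside-W (keep sl PS) , indT) , sizes) ◅ rest' , PT'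

  slide-target : ∀ {W S T} → Slide G W S T → ∀ {x} → x ∈ S → x ∉ T →
                 ∃[ z ] (z ∈ T × z ∉ S × Adj G x z)
  slide-target {S = S} {T} ((_ , indS) , _ , _ , ∣S△T∣≡2 , adj) {x} x∈S x∉T
    with another (S △ T) x (ℕ.≤-reflexive (sym ∣S△T∣≡2))
  ... | z , z∈S△T , z≢x with △-elim S T z∈S△T
  ... | inj₁ (z∈S , _)   = ⊥-elim (indS x z x∈S z∈S x-z)
    where x-z = adj x z (△-intro S T x∈S x∉T) z∈S△T (≢-sym z≢x)
  ... | inj₂ (z∈T , z∉S) = z , z∈T , z∉S , adj x z (△-intro S T x∈S x∉T) z∈S△T (≢-sym z≢x)

  slide-stays : ∀ {W S T} → Slide G W S T → ∀ {x y} → x ∈ S → y ∈ S → x ≢ y →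
                x ∉ T → y ∈ T
  slide-stays {S = S} {T} ((_ , indS) , _ , _ , _ , adj) {x} {y} x∈S y∈S x≢y x∉T
    with y ∈? T
  ... | yes y∈T = y∈T
  ... | no y∉T = ⊥-elim (indS x y x∈S y∈S
                          (adj x y (△-intro S T x∈S x∉T) (△-intro S T y∈S y∉T) x≢y))

module _ (G : Graph n) (M : Subset n) (modM : IsModule G M) where

  module-spread : ∀ {v u w} → v ∉ M → u ∈ M → w ∈ M → Adj G v u → Adj G v w
  module-spread {v} v∉M u∈M w∈M v-u with modM v v∉M
  ... | inj₁ all  = all _ w∈M
  ... | inj₂ none = contradiction v-u (none _ u∈M)

  record Anchored (T : Subset n) : Set where
    constructor anchors
    field
      {a b} : Fin n
      a∈T   : a ∈ T
      a∈M   : a ∈ M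
      b∈T   : b ∈ T
      b∈M   : b ∈ M
      a≢b   : a ≢ b

  -- The invariant of reconfiguration sequences starting at S.
  AnchoredIndep : Subset n → Set
  AnchoredIndep T = Independent G T × Anchored T

  anchored-avoids-N : ∀ {T} → AnchoredIndep T → ∀ v → v ∈ T → ¬ NbhdOf G M v
  anchored-avoids-N ((_ , indT) , anchors a∈T a∈M _ _ _) v v∈T (v∉M , u , u∈M , u-v) =
    indT v _ v∈T a∈T (module-spread v∉M u∈M a∈M (symm G u-v))

  slide-reanchors : ∀ {W S T} → Slide G W S T → ∀ {x y} → x ∈ S → x ∈ M →
                    y ∈ S → y ∈ M → x ≢ y → x ∉ T → Anchored T
  slide-reanchors sl@(_ , (_ , indT) , _) x∈S x∈M y∈S y∈M x≢y x∉T
    with slide-target G sl x∈S x∉T | slide-stays G sl x∈S y∈S x≢y x∉T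
  ... | z , z∈T , z∉S , x-z | y∈T with z ∈? M
  ... | yes z∈M = anchors z∈T z∈M y∈T y∈M (λ { refl → z∉S y∈S })
  ... | no z∉M  = ⊥-elim (indT _ _ z∈T y∈T (module-spread z∉M x∈M y∈M (symm G x-z)))

  slide-keeps-anchored : ∀ {W S T} → Slide G W S T → Anchored S → Anchored T
  slide-keeps-anchored {T = T} sl (anchors a∈S a∈M b∈S b∈M a≢b)
    with _ ∈? T | _ ∈? T
  ... | yes a∈T | yes b∈T = anchors a∈T a∈M b∈T b∈M a≢b
  ... | no a∉T  | _       = slide-reanchors sl a∈S a∈M b∈S b∈M a≢b a∉T
  ... | yes _   | no b∉T  = slide-reanchors sl b∈S b∈M a∈S a∈M (≢-sym a≢b) b∉T

  slide-keeps-invariant : ∀ {S T} → Slide G allV S T → AnchoredIndep S → AnchoredIndep T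
  slide-keeps-invariant sl@(_ , indT , _) (_ , ancS) = indT , slide-keeps-anchored sl ancS

  anchored-from-size : ∀ {S} → ∣ S ∩ M ∣ ≥ 2 → Anchored S
  anchored-from-size {S} 2≤∣S∩M∣
    with size≥1⇒nonempty (S ∩ M) (ℕ.≤-trans (s≤s z≤n) 2≤∣S∩M∣)
  ... | a , a∈S∩M with another (S ∩ M) a 2≤∣S∩M∣
  ... | b , b∈S∩M , b≢a with x∈p∩q⁻ S M a∈S∩M | x∈p∩q⁻ S M b∈S∩M
  ... | a∈S , a∈M | b∈S , b∈M = anchors a∈S a∈M b∈S b∈M (≢-sym b≢a)

lemma7 : ∀ {n} (G : Graph n) (M S : Subset n) → IsModule G M → Independent G S →
         ∣ S ∩ M ∣ ≥ 2 → ∀ (S' : Subset n) → Independent G S' →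
         Reach G allV S S' ⇔ ((∀ v → v ∈ S' → ¬ NbhdOf G M v) × Reach G (minusN G M) S S')
lemma7 G M S modM indS 2≤∣S∩M∣ S' _ = mk⇔ to from
  where
    to : Reach G allV S S' → (∀ v → v ∈ S' → ¬ NbhdOf G M v) × Reach G (minusN G M) S S'
    to r with reach-restrict G (AnchoredIndep G M modM)
                (slide-keeps-invariant G M modM) (anchored-avoids-N G M modM)
                r (indS , anchored-from-size G M modM 2≤∣S∩M∣)
    ... | r' , invS' = anchored-avoids-N G M modM invS' , r'

    from : (∀ v → v ∈ S' → ¬ NbhdOf G M v) × Reach G (minusN G M) S S' → Reach G allV S S'
    from (_ , r) = Star.map (slide-in-G G) r
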